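{- Let $G$ be a subgraph of the $n \times n$ knight's graph $K_n$. Then every edge (move) of $G$ is part of at most 6 rails of $G$.
   Context: For $n \in \mathbb{N}$, the knight's graph $K_n$ is the undirected graph whose vertices are the $n^2$ cells of an $n\times n$ chessboard, with an edge between two cells iff a chess knight can move from one to the other (i.e. their column and row displacements are $(\pm1,\pm2)$ or $(\pm2,\pm1)$). For cells $u,v$ joined by a knight move, let $\mathrm{km}(u,v)$ denote the knight move (one of the 8 displacement vectors) taking $u$ to $v$. A rail in a subgraph $G$ of $K_n$ is an unordered pair of edges $(e,e')$ of $G$ with $e=(v_0,v_1)$, $e'=(v_2,v_3)$, such that the two moves are parallel and separated by knight's moves, i.e. $\mathrm{km}(v_0,v_1)=\mathrm{km}(v_2,v_3)$ and $\mathrm{km}(v_0,v_2)=\mathrm{km}(v_1,v_3)$, and such that $(v_0,v_2)$ and $(v_1,v_3)$ are edges of $K_n$ that are not edges of $G$. -}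

module Defs where

open import Data.Nat using (ℕ)
open import Data.Fin using (Fin; toℕ)
open import Data.Integer using (ℤ; _-_; +_; ∣_∣)
open import Data.Product using (_×_; _,_; proj₁; proj₂; ∃₂)
open import Data.Sum using (_⊎_)
open import Data.List using (List; length)
open import Data.List.Relation.Unary.All using (All)
open import Data.List.Relation.Unary.AllPairs using (AllPairs)
open import Relation.Nullary using (¬_)
open import Relation.Binary.PropositionalEquality using (_≡_)
open import Level using (Level; suc; _⊔_)

Cell : ℕ → Set
Cell n = Fin n × Fin n

disp : ∀ {n} → Cell n → Cell n → ℤ × ℤ
disp (c₁ , r₁) (c₂ , r₂) = ((+ toℕ c₂) - (+ toℕ c₁)) , ((+ toℕ r₂) - (+ toℕ r₁))

IsKnightMove : ℤ × ℤ → Set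
IsKnightMove (dx , dy) = (∣ dx ∣ ≡ 1 × ∣ dy ∣ ≡ 2) ⊎ (∣ dx ∣ ≡ 2 × ∣ dy ∣ ≡ 1)

Adj : ∀ {n} → Cell n → Cell n → Set
Adj u v = IsKnightMove (disp u v)

km : ∀ {n} → Cell n → Cell n → ℤ × ℤ
km = disp

-- A subgraph of K_n, given by its (undirected) edge relation.
-- (Its vertex set plays no role for rails, so only edges are recorded.)
record Subgraph (n : ℕ) : Set₁ where
  field
    E     : Cell n → Cell n → Set
    E-sym : ∀ {u v} → E u v → E v u
    E-sub : ∀ {u v} → E u v → Adj u v

open Subgraph public

RailO : ∀ {n} → Subgraph n → Cell n → Cell n → Cell n → Cell n → Set
RailO G v₀ v₁ v₂ v₃ =
  E G v₀ v₁ × E G v₂ v₃ ×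
  km v₀ v₁ ≡ km v₂ v₃ × km v₀ v₂ ≡ km v₁ v₃ ×
  Adj v₀ v₂ × Adj v₁ v₃ ×
  ¬ E G v₀ v₂ × ¬ E G v₁ v₃

IsRail : ∀ {n} → Subgraph n → Cell n → Cell n → Cell n → Cell n → Set
IsRail G a b c d =
  ∃₂ λ v₀ v₁ → ∃₂ λ v₂ v₃ →
    ((v₀ ≡ a × v₁ ≡ b) ⊎ (v₀ ≡ b × v₁ ≡ a)) ×
    ((v₂ ≡ c × v₃ ≡ d) ⊎ (v₂ ≡ d × v₃ ≡ c)) ×
    RailO G v₀ v₁ v₂ v₃

SameEdge : ∀ {n} → Cell n × Cell n → Cell n × Cell n → Set
SameEdge (c , d) (c' , d') = (c ≡ c' × d ≡ d') ⊎ (c ≡ d' × d ≡ c')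

-- Each rail partner {c,d} of an edge {a,b} of G is the translate of {a,b} by the knight
-- move m = km(a,c) (after orienting the two edges suitably), and m determines the partner.
-- Moreover m differs from km(a,b) and km(b,a): otherwise a cross edge of the rail would
-- coincide with {a,b} itself, which lies in G. So distinct rail partners give distinct
-- knight moves, all different from the two moves km(a,b) ≠ km(b,a) along the edge, and
-- there are only 8 knight moves.
module Submission where

open import Defs
open import Data.Nat using (ℕ; _+_; _≤_; suc; z≤n; s≤s)
open import Data.Nat.Properties using (1+n≢0; +-cancelˡ-≤; module ≤-Reasoning)
open import Data.Fin using (Fin; toℕ)
open import Data.Fin.Properties using (toℕ-injective)
open import Data.Integer using (ℤ; +_; -[1+_]; +[1+_]; -_; _-_; ∣_∣)
open import Data.Integer.Properties as ℤ using (+-0-abelianGroup)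
open import Algebra.Properties.AbelianGroup +-0-abelianGroup using (∙-cancelʳ; ⁻¹-anti-homo‿-)
open import Data.Product using (_×_; _,_; proj₁; proj₂; ∃; -,_)
open import Data.Sum using (_⊎_; inj₁; inj₂)
open import Data.List using (List; []; _∷_; _++_; length; cartesianProduct)
open import Data.List.Relation.Unary.All as All using (All; []; _∷_; reduce)
open import Data.List.Relation.Unary.AllPairs using (AllPairs; []; _∷_)
open import Data.List.Relation.Unary.Any using (here; there)
open import Data.List.Relation.Unary.Unique.Propositional using (Unique)
open import Data.List.Membership.Propositional using (_∈_)
open import Data.List.Membership.Propositional.Properties
  using (∈-∃++; ∈-++⁺ˡ; ∈-++⁺ʳ; ∈-cartesianProduct⁺)
open import Data.List.Relation.Binary.Subset.Propositional using (_⊆_)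
open import Data.List.Relation.Binary.Permutation.Propositional using (_↭_)
open import Data.List.Relation.Binary.Permutation.Propositional.Properties
  using (shift; ↭-length; ∈-resp-↭)
open import Relation.Nullary using (¬_; contradiction)
open import Relation.Binary.PropositionalEquality

Unique-⊆⇒length-≤ : ∀ {A : Set} {xs ys : List A} → Unique xs → xs ⊆ ys → length xs ≤ length ys
Unique-⊆⇒length-≤ [] _ = z≤n
Unique-⊆⇒length-≤ {xs = x ∷ xs} (x∉xs ∷ xs!) x∷xs⊆ys
  with us , vs , refl ← ∈-∃++ (x∷xs⊆ys (here refl)) = begin
    suc (length xs)          ≤⟨ s≤s (Unique-⊆⇒length-≤ xs! xs⊆us++vs) ⟩
    suc (length (us ++ vs))  ≡⟨ ↭-length σ ⟨
    length (us ++ x ∷ vs)    ∎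
  where
  open ≤-Reasoning
  σ : us ++ x ∷ vs ↭ x ∷ us ++ vs
  σ = shift x us vs

  xs⊆us++vs : xs ⊆ us ++ vs
  xs⊆us++vs y∈xs with ∈-resp-↭ σ (x∷xs⊆ys (there y∈xs))
  ... | here refl  = contradiction refl (All.lookup x∉xs y∈xs)
  ... | there y∈zs = y∈zs

module _ {A B : Set} {P : A → Set} (f : ∀ {x} → P x → B) where

  length-reduce : ∀ {xs} (ps : All P xs) → length (reduce f ps) ≡ length xs
  length-reduce []       = refl
  length-reduce (_ ∷ ps) = cong suc (length-reduce ps)

  All-reduce : ∀ {Q : B → Set} → (∀ {x} (p : P x) → Q (f p)) →
               ∀ {xs} (ps : All P xs) → All Q (reduce f ps)
  All-reduce Q-f []       = []
  All-reduce Q-f (p ∷ ps) = Q-f p ∷ All-reduce Q-f ps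

  AllPairs-reduce : ∀ {R : A → A → Set} {R′ : B → B → Set} →
                    (∀ {x y} (p : P x) (q : P y) → R x y → R′ (f p) (f q)) →
                    ∀ {xs} (ps : All P xs) → AllPairs R xs → AllPairs R′ (reduce f ps)
  AllPairs-reduce             R⇒R′ []       []         = []
  AllPairs-reduce {R} {R′} R⇒R′ (p ∷ ps) (Rx ∷ Rxs) =
    All-R⇒All-R′ p Rx ps ∷ AllPairs-reduce R⇒R′ ps Rxs
    where
    All-R⇒All-R′ : ∀ {x ys} (p : P x) → All (R x) ys → (qs : All P ys) → All (R′ (f p)) (reduce f qs)
    All-R⇒All-R′ p []         []       = []
    All-R⇒All-R′ p (Rxy ∷ Rs) (q ∷ qs) = R⇒R′ p q Rxy ∷ All-R⇒All-R′ p Rs qs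

disp-injectiveʳ : ∀ {n} (u : Cell n) {v w : Cell n} → disp u v ≡ disp u w → v ≡ w
disp-injectiveʳ (c , r) eq = cong₂ _,_ (coordinate c (cong proj₁ eq)) (coordinate r (cong proj₂ eq))
  where
  coordinate : ∀ {n} (x : Fin n) {y z : Fin n} → + toℕ y - + toℕ x ≡ + toℕ z - + toℕ x → y ≡ z
  coordinate x eq = toℕ-injective (ℤ.+-injective (∙-cancelʳ (- + toℕ x) _ _ eq))

proj₁-disp-swap : ∀ {n} (u v : Cell n) → proj₁ (disp v u) ≡ - proj₁ (disp u v)
proj₁-disp-swap (c , _) (c′ , _) = sym (⁻¹-anti-homo‿- (+ toℕ c′) (+ toℕ c))

≢-self-neg : ∀ {i} → ∣ i ∣ ≢ 0 → i ≢ - i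
≢-self-neg {+ 0}      ∣i∣≢0 _ = ∣i∣≢0 refl
≢-self-neg {+[1+ _ ]} _     ()
≢-self-neg { -[1+ _ ]} _    ()

IsKnightMove⇒∣dx∣≢0 : ∀ {m} → IsKnightMove m → ∣ proj₁ m ∣ ≢ 0
IsKnightMove⇒∣dx∣≢0 (inj₁ (∣dx∣≡1 , _)) ∣dx∣≡0 = 1+n≢0 (trans (sym ∣dx∣≡1) ∣dx∣≡0)
IsKnightMove⇒∣dx∣≢0 (inj₂ (∣dx∣≡2 , _)) ∣dx∣≡0 = 1+n≢0 (trans (sym ∣dx∣≡2) ∣dx∣≡0)

Adj⇒km≢reverse-km : ∀ {n} (u v : Cell n) → Adj u v → km u v ≢ km v u
Adj⇒km≢reverse-km u v u~v eq =
  ≢-self-neg (IsKnightMove⇒∣dx∣≢0 {km u v} u~v) (trans (cong proj₁ eq) (proj₁-disp-swap u v))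

signed : ℕ → List ℤ
signed k = + k ∷ - + k ∷ []

∈-signed : ∀ {i k} → ∣ i ∣ ≡ k → i ∈ signed k
∈-signed {+ _}      refl = here refl
∈-signed { -[1+ _ ]} refl = there (here refl)

knightMoves : List (ℤ × ℤ)
knightMoves = cartesianProduct (signed 1) (signed 2) ++ cartesianProduct (signed 2) (signed 1)

IsKnightMove⇒∈knightMoves : ∀ {m} → IsKnightMove m → m ∈ knightMoves
IsKnightMove⇒∈knightMoves (inj₁ (∣dx∣≡1 , ∣dy∣≡2)) =
  ∈-++⁺ˡ (∈-cartesianProduct⁺ (∈-signed ∣dx∣≡1) (∈-signed ∣dy∣≡2))
IsKnightMove⇒∈knightMoves (inj₂ (∣dx∣≡2 , ∣dy∣≡1)) =
  ∈-++⁺ʳ (cartesianProduct (signed 1) (signed 2))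
         (∈-cartesianProduct⁺ (∈-signed ∣dx∣≡2) (∈-signed ∣dy∣≡1))

module _ {n : ℕ} where

  disp-target-unique : ∀ (u : Cell n) {v w m} → disp u v ≡ m → disp u w ≡ m → v ≡ w
  disp-target-unique u uv uw = disp-injectiveʳ u (trans uv (sym uw))

  data TranslateOf (a b : Cell n) (m : ℤ × ℤ) : Cell n × Cell n → Set where
    aligned : ∀ {c d} → km a c ≡ m → km b d ≡ m → TranslateOf a b m (c , d)
    crossed : ∀ {c d} → km a d ≡ m → km b c ≡ m → TranslateOf a b m (c , d)

  TranslateOf-unique : ∀ {a b m e e′} → TranslateOf a b m e → TranslateOf a b m e′ → SameEdge e e′
  TranslateOf-unique {a} {b} (aligned ac bd) (aligned ac′ bd′) =
    inj₁ (disp-target-unique a ac ac′ , disp-target-unique b bd bd′)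
  TranslateOf-unique {a} {b} (aligned ac bd) (crossed ad′ bc′) =
    inj₂ (disp-target-unique a ac ad′ , disp-target-unique b bd bc′)
  TranslateOf-unique {a} {b} (crossed ad bc) (aligned ac′ bd′) =
    inj₂ (disp-target-unique b bc bd′ , disp-target-unique a ad ac′)
  TranslateOf-unique {a} {b} (crossed ad bc) (crossed ad′ bc′) =
    inj₁ (disp-target-unique b bc bc′ , disp-target-unique a ad ad′)

  TranslateOf-swapˡ : ∀ {a b m e} → TranslateOf a b m e → TranslateOf b a m e
  TranslateOf-swapˡ (aligned ac bd) = crossed bd ac
  TranslateOf-swapˡ (crossed ad bc) = aligned bc ad

  TranslateOf-swapʳ : ∀ {a b m c d} → TranslateOf a b m (c , d) → TranslateOf a b m (d , c)
  TranslateOf-swapʳ (aligned ac bd) = crossed ac bd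
  TranslateOf-swapʳ (crossed ad bc) = aligned ad bc

  record CrossMove (a b : Cell n) (e : Cell n × Cell n) (m : ℤ × ℤ) : Set where
    field
      knight    : IsKnightMove m
      ≢forward  : km a b ≢ m
      ≢backward : km b a ≢ m
      translate : TranslateOf a b m e

  open CrossMove

  CrossMove-swapˡ : ∀ {a b e m} → CrossMove a b e m → CrossMove b a e m
  CrossMove-swapˡ x = record
    { knight    = knight x
    ; ≢forward  = ≢backward x
    ; ≢backward = ≢forward x
    ; translate = TranslateOf-swapˡ (translate x)
    }

  CrossMove-swapʳ : ∀ {a b c d m} → CrossMove a b (c , d) m → CrossMove a b (d , c) m
  CrossMove-swapʳ x = record
    { knight    = knight x
    ; ≢forward  = ≢forward x
    ; ≢backward = ≢backward x
    ; translate = TranslateOf-swapʳ (translate x)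
    }

  module _ (G : Subgraph n) where

    RailO⇒CrossMove : ∀ {v₀ v₁ v₂ v₃} → RailO G v₀ v₁ v₂ v₃ →
                      CrossMove v₀ v₁ (v₂ , v₃) (km v₀ v₂)
    RailO⇒CrossMove {v₀} {v₁} (e₀₁ , _ , _ , k₀₂≡k₁₃ , v₀~v₂ , _ , ¬e₀₂ , ¬e₁₃) = record
      { knight    = v₀~v₂
      ; ≢forward  = λ k₀₁≡k₀₂ → ¬e₀₂ (subst (E G v₀) (disp-injectiveʳ v₀ k₀₁≡k₀₂) e₀₁)
      ; ≢backward = λ k₁₀≡k₀₂ →
          ¬e₁₃ (subst (E G v₁) (disp-injectiveʳ v₁ (trans k₁₀≡k₀₂ k₀₂≡k₁₃)) (E-sym G e₀₁))
      ; translate = aligned refl (sym k₀₂≡k₁₃)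
      }

    IsRail⇒CrossMove : ∀ {a b c d} → IsRail G a b c d → ∃ (CrossMove a b (c , d))
    IsRail⇒CrossMove (_ , _ , _ , _ , inj₁ (refl , refl) , inj₁ (refl , refl) , r) =
      -, RailO⇒CrossMove r
    IsRail⇒CrossMove (_ , _ , _ , _ , inj₁ (refl , refl) , inj₂ (refl , refl) , r) =
      -, CrossMove-swapʳ (RailO⇒CrossMove r)
    IsRail⇒CrossMove (_ , _ , _ , _ , inj₂ (refl , refl) , inj₁ (refl , refl) , r) =
      -, CrossMove-swapˡ (RailO⇒CrossMove r)
    IsRail⇒CrossMove (_ , _ , _ , _ , inj₂ (refl , refl) , inj₂ (refl , refl) , r) =
      -, CrossMove-swapˡ (CrossMove-swapʳ (RailO⇒CrossMove r))

lemma1 : (n : ℕ) (G : Subgraph n) (a b : Cell n) → E G a b →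
    (es : List (Cell n × Cell n)) →
    All (λ cd → IsRail G a b (proj₁ cd) (proj₂ cd)) es →
    AllPairs (λ e e' → ¬ SameEdge e e') es →
    length es ≤ 6
lemma1 n G a b ab∈G es rails distinct = +-cancelˡ-≤ 2 (length es) 6 (begin
  2 + length es  ≡⟨ cong (λ k → 2 + k) (length-reduce proj₁ crossings) ⟨
  length moves   ≤⟨ Unique-⊆⇒length-≤ moves-unique (All.lookup moves-knight) ⟩
  length knightMoves ∎)
  where
  open ≤-Reasoning

  a~b : Adj a b
  a~b = E-sub G ab∈G

  crossings : All (λ e → ∃ (CrossMove a b e)) es
  crossings = All.map (IsRail⇒CrossMove G) rails

  moves : List (ℤ × ℤ)
  moves = km a b ∷ km b a ∷ reduce proj₁ crossings

  moves-knight : All (_∈ knightMoves) moves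
  moves-knight =
    IsKnightMove⇒∈knightMoves a~b ∷
    IsKnightMove⇒∈knightMoves (E-sub G (E-sym G ab∈G)) ∷
    All-reduce proj₁ (λ (_ , x) → IsKnightMove⇒∈knightMoves (CrossMove.knight x)) crossings

  moves-unique : Unique moves
  moves-unique =
    (Adj⇒km≢reverse-km a b a~b ∷ All-reduce proj₁ (λ (_ , x) → CrossMove.≢forward x) crossings) ∷
    All-reduce proj₁ (λ (_ , x) → CrossMove.≢backward x) crossings ∷
    AllPairs-reduce proj₁ (λ { (_ , x) (_ , x′) ¬same refl →
      ¬same (TranslateOf-unique (CrossMove.translate x) (CrossMove.translate x′)) })
      crossings distinct
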